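{- Let $n\ge1$ and let $0^l\sigma w\neq 0^n$ be a key-word of length $n$ ($\sigma$ a symbol, $l\ge0$), and let $0<p\le l$. Then $0^p\sigma w0^{l-p}<\sigma w0^l$.
   Context: Words are over $\mathbb N$; $\sigma^t$ denotes $t$ repetitions of $\sigma$. A rotation of $xy$ is $yx$. For words of equal length, $w_1\le_{\mathrm{colex}} w_2$ means the reversal of $w_1$ is lexicographically $\le$ the reversal of $w_2$. A key-word is a length-$n$ word colex-maximal among its rotations. For $k\ge1$ let $c(n,k)$ be the number of key-words in $[k]^n$ ($[k]=\{0,\dots,k-1\}$), listed in increasing colex order $\mathrm{key}_0<\cdots<\mathrm{key}_{c(n,k)-1}$ (consistently in $k$). Cycles: $C_0=(0^n)$. For $m\ge1$ write $\mathrm{key}_m=0^l(\sigma+1)w$; $C_m$ is the sequence of all distinct rotations of $\mathrm{key}_m$, starting with $\mathrm{first}(C_m)=w0^l(\sigma+1)$, in which each word $\tau w'$ is followed by $w'\tau$, ending with $\mathrm{last}(C_m)=(\sigma+1)w0^l$. Construction: $D_0=(0^n)$; writing $\mathrm{key}_{m+1}=0^l(\sigma+1)w$, $D_{m+1}$ is obtained from $D_m$ by inserting the sequence $C_{m+1}$ immediately after the word $\sigma w0^l$ of $D_m$. $D(n,k)=D_{c(n,k)-1}$. For length-$n$ words $u,v$, $u<v$ means $u$ appears before $v$ in $D(n,k)$ for some (equivalently any) $k$ with $u,v\in[k]^n$. -}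

module Defs where

open import Data.Nat using (ℕ; zero; suc; _+_; _∸_; _<_; _≤_; _<ᵇ_; _≡ᵇ_)
open import Data.Bool using (Bool; true; false; if_then_else_; _∧_; T)
open import Data.List using (List; []; _∷_; _++_; length; reverse; drop; take;
  replicate; map; concatMap; upTo; foldl; filter)
open import Data.List.Relation.Unary.All using (All)
open import Data.Product using (Σ; _×_; ∃; _,_)
open import Relation.Binary.PropositionalEquality using (_≡_)

Word : Set
Word = List ℕ

_==ʷ_ : Word → Word → Bool
[] ==ʷ [] = true
(x ∷ xs) ==ʷ (y ∷ ys) = (x ≡ᵇ y) ∧ (xs ==ʷ ys)
_ ==ʷ _ = false

lexLeq : Word → Word → Bool
lexLeq [] _ = true
lexLeq (x ∷ xs) [] = false
lexLeq (x ∷ xs) (y ∷ ys) =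
  if x <ᵇ y then true else (if x ≡ᵇ y then lexLeq xs ys else false)

colexLeq : Word → Word → Bool
colexLeq u v = lexLeq (reverse u) (reverse v)

-- rotate i (x y) = y x where |x| = i  (for i ≤ length).
rotate : ℕ → Word → Word
rotate i u = drop i u ++ take i u

IsKeyWord : ℕ → Word → Set
IsKeyWord n u = length u ≡ n × (∀ i → i ≤ n → T (colexLeq (rotate i u) u))

allB : {A : Set} → (A → Bool) → List A → Bool
allB f [] = true
allB f (x ∷ xs) = f x ∧ allB f xs

isKeyB : Word → Bool
isKeyB u = allB (λ i → colexLeq (rotate i u) u) (upTo (length u))

wordsLex : ℕ → ℕ → List Word
wordsLex k zero = [] ∷ []
wordsLex k (suc n) = concatMap (λ a → map (a ∷_) (wordsLex k n)) (upTo k)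

wordsColex : ℕ → ℕ → List Word
wordsColex k n = map reverse (wordsLex k n)

keys : ℕ → ℕ → List Word
keys n k = filter (λ u → isKeyB u Data.Bool.≟ true) (wordsColex k n)

rot1 : Word → Word
rot1 [] = []
rot1 (x ∷ xs) = xs ++ x ∷ []

-- Number of distinct rotations: least d ≥ 1 with rotate d u = u (default: length u).
private
  findPeriod : Word → List ℕ → ℕ → ℕ
  findPeriod u [] dflt = dflt
  findPeriod u (d ∷ ds) dflt = if rotate d u ==ʷ u then d else findPeriod u ds dflt

numRotations : Word → ℕ
numRotations u = findPeriod u (map suc (upTo (length u))) (length u)

iterRot : ℕ → Word → List Word
iterRot zero u = []
iterRot (suc d) u = u ∷ iterRot d (rot1 u)

leadingZeros : Word → ℕ × Word
leadingZeros (zero ∷ xs) with leadingZeros xs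
... | (l , r) = (suc l , r)
leadingZeros xs = (zero , xs)

insertAfter : Word → List Word → List Word → List Word
insertAfter t s [] = []
insertAfter t s (x ∷ xs) = if x ==ʷ t then x ∷ (s ++ xs) else x ∷ insertAfter t s xs

-- D_{m+1} from D_m: key_{m+1} = 0^l (σ+1) w; C_{m+1} consists of the distinct
-- rotations of key_{m+1} starting with w 0^l (σ+1), each τw' followed by w'τ;
-- it is inserted right after σ w 0^l.
step : List Word → Word → List Word
step D key with leadingZeros key
... | (l , suc σ ∷ w) =
  insertAfter (σ ∷ w ++ replicate l 0)
              (iterRot (numRotations key) (w ++ replicate l 0 ++ suc σ ∷ []))
              D
... | _ = D

-- D(n,k) = D_{c(n,k)-1}, starting from D_0 = (0^n) and processing key_1, key_2, ...
Dseq : ℕ → ℕ → List Word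
Dseq n k = foldl step (replicate n 0 ∷ []) (drop 1 (keys n k))

AppearsBefore : List Word → Word → Word → Set
AppearsBefore L u v =
  Σ (List Word) λ xs → Σ (List Word) λ ys → Σ (List Word) λ zs →
    L ≡ xs ++ u ∷ ys ++ v ∷ zs

Before : ℕ → Word → Word → Set
Before n u v = ∃ λ k → All (_< k) u × All (_< k) v × AppearsBefore (Dseq n k) u v

-- Write the key-word as K = 0^L (τ+1) w, so that L ≥ l.  When K is processed, its cycle, i.e. the
-- rotations of K starting from w 0^L (τ+1), is inserted as one contiguous block, and later insertions
-- never drop or reorder words already present; inside that block the rotation of K by a precedes
-- its rotation by b whenever a < b ≤ L, and a = l − p, b = l give the claim.  The insertion really
-- takes place: the insertion point τ w 0^L is the rotation of K by L with its first letter
-- decremented, so its maximal rotation is a key-word colex-smaller than K.  That key-word was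
-- processed earlier, and by induction over the construction every rotation of an earlier key-word
-- is already in the list.
module Submission where

open import Defs
open import Data.Bool using (Bool; true; false; T)
import Data.Bool
open import Data.Bool.Properties using (T-∧; T-≡)
open import Data.Empty using (⊥-elim)
open import Data.List
  using (List; []; _∷_; _++_; [_]; length; reverse; replicate; take; drop; map; upTo; applyUpTo; foldl)
open import Data.List.Properties
  using (++-assoc; ++-identityʳ; length-++; length-replicate; length-take; take++drop≡id; reverse-++;
         unfold-reverse; reverse-involutive; length-reverse; filter-accept; foldl-++)
import Data.List.Extrema
open import Data.List.Membership.Propositional using (_∈_; find; lose)
open import Data.List.Membership.Propositional.Properties
  using (∈-map⁺; ∈-map⁻; ∈-concatMap⁺; ∈-concatMap⁻; ∈-upTo⁺; ∈-upTo⁻; ∈-filter⁺; ∈-filter⁻;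
         ∈-∃++; ∈-++⁺ʳ; ∈-++⁻)
open import Data.List.Relation.Binary.Lex.Strict using (Lex-<; Lex-≤; base; halt; this; next)
import Data.List.Relation.Binary.Lex.Strict as Lex
open import Data.List.Relation.Binary.Pointwise using (≡⇒Pointwise-≡)
open import Data.List.Relation.Binary.Sublist.Propositional
  using (_⊆_; []; _∷_; _∷ʳ_; ⊆-refl; ⊆-trans; to∈; from∈) renaming (lookup to lookup-⊆)
import Data.List.Relation.Binary.Sublist.Propositional.Properties as Sublist
open import Data.List.Relation.Unary.All using (All; []; _∷_; universal; lookup) renaming (map to All-map)
import Data.List.Relation.Unary.All.Properties as All
open import Data.List.Relation.Unary.AllPairs using (AllPairs; []; _∷_)
import Data.List.Relation.Unary.AllPairs as AP
import Data.List.Relation.Unary.AllPairs.Properties as AllPairs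
open import Data.List.Relation.Unary.Any using (here; there)
open import Data.Nat
  using (ℕ; zero; suc; _+_; _*_; _∸_; _%_; _/_; _<_; _≤_; _<ᵇ_; _≡ᵇ_; NonZero; >-nonZero; z≤n; s≤s)
open import Data.Nat.DivMod using (m≡m%n+[m/n]*n; m%n<n)
open import Data.Nat.ListAction using (sum)
open import Data.Nat.Properties
open import Data.Product using (Σ; ∃; ∃₂; _×_; _,_; proj₁; proj₂)
open import Data.Sum using (_⊎_; inj₁; inj₂)
open import Data.Unit using (tt)
open import Function using (_∘_)
open import Function.Bundles using (Equivalence)
open import Relation.Binary.Bundles using (StrictTotalOrder; DecTotalOrder)
open import Relation.Binary.PropositionalEquality
  using (_≡_; _≢_; refl; sym; trans; cong; cong₂; subst; subst₂; module ≡-Reasoning)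
open import Relation.Nullary using (¬_; Dec)

-- Boolean tests and the lexicographic and colexicographic orders

==ʷ-sound : ∀ u v → T (u ==ʷ v) → u ≡ v
==ʷ-sound []      []      _    = refl
==ʷ-sound (x ∷ u) (y ∷ v) u==v =
  let x≡y , u≡v = Equivalence.to T-∧ u==v in cong₂ _∷_ (≡ᵇ⇒≡ x y x≡y) (==ʷ-sound u v u≡v)

==ʷ-refl : ∀ u → T (u ==ʷ u)
==ʷ-refl []      = tt
==ʷ-refl (x ∷ u) = Equivalence.from T-∧ (≡⇒≡ᵇ x x refl , ==ʷ-refl u)

<ᵇ-irrefl : ∀ x → (x <ᵇ x) ≡ false
<ᵇ-irrefl zero    = refl
<ᵇ-irrefl (suc x) = <ᵇ-irrefl x

≡ᵇ-refl : ∀ x → (x ≡ᵇ x) ≡ true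
≡ᵇ-refl zero    = refl
≡ᵇ-refl (suc x) = ≡ᵇ-refl x

infix 4 _<ˡ_ _≤ˡ_ _<ᶜ_ _≤ᶜ_

_<ˡ_ _≤ˡ_ _<ᶜ_ _≤ᶜ_ : Word → Word → Set
_<ˡ_ = Lex-< _≡_ _<_
_≤ˡ_ = Lex-≤ _≡_ _<_
u <ᶜ v = reverse u <ˡ reverse v
u ≤ᶜ v = reverse u ≤ˡ reverse v

lexLeq⇒≤ˡ : ∀ u v → T (lexLeq u v) → u ≤ˡ v
lexLeq⇒≤ˡ []      []      _ = base tt
lexLeq⇒≤ˡ []      (_ ∷ _) _ = halt
lexLeq⇒≤ˡ (x ∷ u) (y ∷ v) u≤v with x <ᵇ y in x<ᵇy
... | true = this (<ᵇ⇒< x y (Equivalence.from T-≡ x<ᵇy))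
... | false with x ≡ᵇ y in x≡ᵇy
...   | true = next (≡ᵇ⇒≡ x y (Equivalence.from T-≡ x≡ᵇy)) (lexLeq⇒≤ˡ u v u≤v)

≤ˡ⇒lexLeq : ∀ {u v} → u ≤ˡ v → T (lexLeq u v)
≤ˡ⇒lexLeq (base _) = tt
≤ˡ⇒lexLeq halt     = tt
≤ˡ⇒lexLeq {x ∷ _} {y ∷ _} (this x<y) with x <ᵇ y | <⇒<ᵇ x<y
... | true | _ = tt
≤ˡ⇒lexLeq {x ∷ _} (next refl u≤v) rewrite <ᵇ-irrefl x | ≡ᵇ-refl x = ≤ˡ⇒lexLeq u≤v

private
  module LexOrder = StrictTotalOrder (Lex.<-strictTotalOrder <-strictTotalOrder)

lexDecTotalOrder : DecTotalOrder _ _ _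
lexDecTotalOrder = Lex.≤-decTotalOrder <-strictTotalOrder

<ˡ-irrefl : ∀ {u} → ¬ u <ˡ u
<ˡ-irrefl = LexOrder.irrefl (≡⇒Pointwise-≡ refl)

<ˡ-trans : ∀ {u v w} → u <ˡ v → v <ˡ w → u <ˡ w
<ˡ-trans = LexOrder.trans

<ˡ-≤ˡ-trans : ∀ {u v w} → u <ˡ v → v ≤ˡ w → u <ˡ w
<ˡ-≤ˡ-trans halt            (this _)        = halt
<ˡ-≤ˡ-trans halt            (next _ _)      = halt
<ˡ-≤ˡ-trans (this x<y)      (this y<z)      = this (<-trans x<y y<z)
<ˡ-≤ˡ-trans (this x<y)      (next refl _)   = this x<y
<ˡ-≤ˡ-trans (next refl _)   (this y<z)      = this y<z
<ˡ-≤ˡ-trans (next refl u<v) (next refl v≤w) = next refl (<ˡ-≤ˡ-trans u<v v≤w)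

≤ᶜ-reflexive : ∀ {u v} → u ≡ v → u ≤ᶜ v
≤ᶜ-reflexive refl = DecTotalOrder.refl lexDecTotalOrder

<ˡ-letter : ∀ (xs : Word) {a b} (ys zs : Word) → a < b → xs ++ a ∷ ys <ˡ xs ++ b ∷ zs
<ˡ-letter []       ys zs a<b = this a<b
<ˡ-letter (x ∷ xs) ys zs a<b = next refl (<ˡ-letter xs ys zs a<b)

reverse-++-∷ : ∀ (xs : Word) a ys → reverse (xs ++ a ∷ ys) ≡ reverse ys ++ a ∷ reverse xs
reverse-++-∷ xs a ys = begin
  reverse (xs ++ a ∷ ys)              ≡⟨ reverse-++ xs (a ∷ ys) ⟩
  reverse (a ∷ ys) ++ reverse xs      ≡⟨ cong (_++ reverse xs) (unfold-reverse a ys) ⟩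
  (reverse ys ++ [ a ]) ++ reverse xs ≡⟨ ++-assoc (reverse ys) [ a ] (reverse xs) ⟩
  reverse ys ++ a ∷ reverse xs        ∎
  where open ≡-Reasoning

<ᶜ-letter : ∀ (xs : Word) {a b} (ys : Word) → a < b → xs ++ a ∷ ys <ᶜ xs ++ b ∷ ys
<ᶜ-letter xs {a} {b} ys a<b =
  subst₂ _<ˡ_ (sym (reverse-++-∷ xs a ys)) (sym (reverse-++-∷ xs b ys))
    (<ˡ-letter (reverse ys) (reverse xs) (reverse xs) a<b)

-- Rotations

rot^ : ℕ → Word → Word
rot^ zero    u = u
rot^ (suc i) u = rot^ i (rot1 u)

rot^-+ : ∀ i j u → rot^ (i + j) u ≡ rot^ j (rot^ i u)
rot^-+ zero    j u = refl
rot^-+ (suc i) j u = rot^-+ i j (rot1 u)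

rot^-comm : ∀ i j u → rot^ i (rot^ j u) ≡ rot^ j (rot^ i u)
rot^-comm i j u = begin
  rot^ i (rot^ j u) ≡⟨ rot^-+ j i u ⟨
  rot^ (j + i) u    ≡⟨ cong (λ m → rot^ m u) (+-comm j i) ⟩
  rot^ (i + j) u    ≡⟨ rot^-+ i j u ⟩
  rot^ j (rot^ i u) ∎
  where open ≡-Reasoning

rot^-++ : ∀ xs ys → rot^ (length xs) (xs ++ ys) ≡ ys ++ xs
rot^-++ []       ys = sym (++-identityʳ ys)
rot^-++ (x ∷ xs) ys = begin
  rot^ (length xs) ((xs ++ ys) ++ [ x ]) ≡⟨ cong (rot^ (length xs)) (++-assoc xs ys [ x ]) ⟩
  rot^ (length xs) (xs ++ ys ++ [ x ])   ≡⟨ rot^-++ xs (ys ++ [ x ]) ⟩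
  (ys ++ [ x ]) ++ xs                    ≡⟨ ++-assoc ys [ x ] xs ⟩
  ys ++ x ∷ xs                           ∎
  where open ≡-Reasoning

rot^-length-period : ∀ u → rot^ (length u) u ≡ u
rot^-length-period u = trans (cong (rot^ (length u)) (sym (++-identityʳ u))) (rot^-++ u [])

length-rot1 : ∀ u → length (rot1 u) ≡ length u
length-rot1 []      = refl
length-rot1 (x ∷ u) = trans (length-++ u) (+-comm (length u) 1)

length-rot^ : ∀ i u → length (rot^ i u) ≡ length u
length-rot^ zero    u = refl
length-rot^ (suc i) u = trans (length-rot^ i (rot1 u)) (length-rot1 u)

rotate≡rot^ : ∀ i u → i ≤ length u → rotate i u ≡ rot^ i u
rotate≡rot^ i u i≤∣u∣ = begin
  drop i u ++ take i u                            ≡⟨ rot^-++ (take i u) (drop i u) ⟨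
  rot^ (length (take i u)) (take i u ++ drop i u) ≡⟨ cong₂ rot^ ∣take∣≡i (take++drop≡id i u) ⟩
  rot^ i u                                        ∎
  where
  open ≡-Reasoning
  ∣take∣≡i : length (take i u) ≡ i
  ∣take∣≡i = trans (length-take i u) (m≤n⇒m⊓n≡m i≤∣u∣)

rot^-inverse : ∀ i u → i ≤ length u → rot^ (length u ∸ i) (rot^ i u) ≡ u
rot^-inverse i u i≤∣u∣ = begin
  rot^ (length u ∸ i) (rot^ i u) ≡⟨ rot^-+ i (length u ∸ i) u ⟨
  rot^ (i + (length u ∸ i)) u    ≡⟨ cong (λ m → rot^ m u) (m+[n∸m]≡n i≤∣u∣) ⟩
  rot^ (length u) u              ≡⟨ rot^-length-period u ⟩
  u                              ∎
  where open ≡-Reasoning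

module _ {d u} (period : rot^ d u ≡ u) where

  rot^-*-period : ∀ q → rot^ (q * d) u ≡ u
  rot^-*-period zero    = refl
  rot^-*-period (suc q) =
    trans (rot^-+ d (q * d) u) (trans (cong (rot^ (q * d)) period) (rot^-*-period q))

  rot^-%-period : ∀ i .{{_ : NonZero d}} → rot^ i u ≡ rot^ (i % d) u
  rot^-%-period i = begin
    rot^ i u                          ≡⟨ cong (λ m → rot^ m u) (trans (m≡m%n+[m/n]*n i d) (+-comm (i % d) _)) ⟩
    rot^ (i / d * d + i % d) u        ≡⟨ rot^-+ (i / d * d) (i % d) u ⟩
    rot^ (i % d) (rot^ (i / d * d) u) ≡⟨ cong (rot^ (i % d)) (rot^-*-period (i / d)) ⟩
    rot^ (i % d) u                    ∎
    where open ≡-Reasoning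

All-rot1 : ∀ {P : ℕ → Set} {u} → All P u → All P (rot1 u)
All-rot1 []        = []
All-rot1 (px ∷ pu) = All.++⁺ pu (px ∷ [])

All-rot^ : ∀ {P : ℕ → Set} i {u} → All P u → All P (rot^ i u)
All-rot^ zero    pu = pu
All-rot^ (suc i) pu = All-rot^ i (All-rot1 pu)

replicate-∷ʳ : ∀ n (x : ℕ) → replicate n x ++ [ x ] ≡ x ∷ replicate n x
replicate-∷ʳ zero    x = refl
replicate-∷ʳ (suc n) x = cong (x ∷_) (replicate-∷ʳ n x)

replicate-+ : ∀ a b (x : ℕ) → replicate (a + b) x ≡ replicate a x ++ replicate b x
replicate-+ zero    b x = refl
replicate-+ (suc a) b x = cong (x ∷_) (replicate-+ a b x)

rot^-replicate : ∀ i n x → rot^ i (replicate n x) ≡ replicate n x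
rot^-replicate zero    n       x = refl
rot^-replicate (suc i) zero    x = rot^-replicate i zero x
rot^-replicate (suc i) (suc n) x =
  trans (cong (rot^ i) (replicate-∷ʳ n x)) (rot^-replicate i (suc n) x)

rot^-replicate-++ : ∀ a x u → rot^ a (replicate a x ++ u) ≡ u ++ replicate a x
rot^-replicate-++ a x u =
  subst (λ m → rot^ m (replicate a x ++ u) ≡ u ++ replicate a x) (length-replicate a) (rot^-++ (replicate a x) u)

rot^-replicate-+ : ∀ a b x u → rot^ a (replicate (a + b) x ++ u) ≡ replicate b x ++ u ++ replicate a x
rot^-replicate-+ a b x u = begin
  rot^ a (replicate (a + b) x ++ u)              ≡⟨ cong (λ xs → rot^ a (xs ++ u)) (replicate-+ a b x) ⟩
  rot^ a ((replicate a x ++ replicate b x) ++ u) ≡⟨ cong (rot^ a) (++-assoc (replicate a x) _ u) ⟩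
  rot^ a (replicate a x ++ replicate b x ++ u)   ≡⟨ rot^-replicate-++ a x _ ⟩
  (replicate b x ++ u) ++ replicate a x          ≡⟨ ++-assoc (replicate b x) u _ ⟩
  replicate b x ++ u ++ replicate a x            ∎
  where open ≡-Reasoning

rot1-letter : ∀ xs ys → ∃₂ λ xs′ ys′ → ∀ a → rot1 (xs ++ a ∷ ys) ≡ xs′ ++ a ∷ ys′
rot1-letter []       ys = ys , [] , λ a → refl
rot1-letter (x ∷ xs) ys = xs , ys ++ [ x ] , λ a → ++-assoc xs (a ∷ ys) [ x ]

rot^-letter : ∀ i xs ys → ∃₂ λ xs′ ys′ → ∀ a → rot^ i (xs ++ a ∷ ys) ≡ xs′ ++ a ∷ ys′
rot^-letter zero    xs ys = xs , ys , λ a → refl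
rot^-letter (suc i) xs ys =
  let xs₁ , ys₁ , rot1≡ = rot1-letter xs ys
      xs₂ , ys₂ , rot^≡ = rot^-letter i xs₁ ys₁
  in xs₂ , ys₂ , λ a → trans (cong (rot^ i) (rot1≡ a)) (rot^≡ a)

-- Key-words as maximal rotations

IsMaxRotation : Word → Set
IsMaxRotation u = ∀ i → rot^ i u ≤ᶜ u

T-allB⁻ : ∀ {A : Set} (f : A → Bool) xs → T (allB f xs) → All (λ x → T (f x)) xs
T-allB⁻ f []       _   = []
T-allB⁻ f (x ∷ xs) all = let fx , fxs = Equivalence.to T-∧ all in fx ∷ T-allB⁻ f xs fxs

T-allB⁺ : ∀ {A : Set} (f : A → Bool) {xs} → All (λ x → T (f x)) xs → T (allB f xs)
T-allB⁺ f []         = tt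
T-allB⁺ f (fx ∷ fxs) = Equivalence.from T-∧ (fx , T-allB⁺ f fxs)

isKeyB⇒IsMaxRotation : ∀ u → 0 < length u → T (isKeyB u) → IsMaxRotation u
isKeyB⇒IsMaxRotation u@(_ ∷ _) _ key i = subst (_≤ᶜ u) (sym rot^i≡rotate) rotate≤u
  where
  n = length u
  i%n<n = m%n<n i n
  rot^i≡rotate : rot^ i u ≡ rotate (i % n) u
  rot^i≡rotate = trans (rot^-%-period (rot^-length-period u) i) (sym (rotate≡rot^ (i % n) u (<⇒≤ i%n<n)))
  rotate≤u : rotate (i % n) u ≤ᶜ u
  rotate≤u = lexLeq⇒≤ˡ _ _ (All.applyUpTo⁻ (λ j → j) n (T-allB⁻ _ (upTo n) key) i%n<n)

IsMaxRotation⇒isKeyB : ∀ u → IsMaxRotation u → T (isKeyB u)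
IsMaxRotation⇒isKeyB u max = T-allB⁺ _ (All.applyUpTo⁺₁ (λ j → j) (length u) λ {i} i<n →
  ≤ˡ⇒lexLeq (subst (_≤ᶜ u) (sym (rotate≡rot^ i u (<⇒≤ i<n))) (max i)))

IsKeyWord⇒isKeyB : ∀ n u → IsKeyWord n u → T (isKeyB u)
IsKeyWord⇒isKeyB n u (refl , key) =
  T-allB⁺ _ (All.applyUpTo⁺₁ (λ j → j) n λ i<n → key _ (<⇒≤ i<n))

maxRotation : ∀ u → 0 < length u → ∃ λ i → i < length u × IsMaxRotation (rot^ i u)
maxRotation u@(_ ∷ _) _ = i , i<n , isMax
  where
  module Extrema = Data.List.Extrema (DecTotalOrder.totalOrder lexDecTotalOrder)
  n = length u
  IsRotation : Word → Set
  IsRotation v = ∃ λ i → i < n × v ≡ rot^ i u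
  rotations = applyUpTo (λ i → rot^ i u) n
  m = Extrema.argmax reverse u rotations
  m-rotation : IsRotation m
  m-rotation = Extrema.argmax-all reverse {P = IsRotation} (0 , s≤s z≤n , refl) (All.applyUpTo⁺₁ _ n λ {i} i<n → i , i<n , refl)
  i = proj₁ m-rotation
  i<n = proj₁ (proj₂ m-rotation)
  isMax : IsMaxRotation (rot^ i u)
  isMax j = subst₂ _≤ᶜ_ (sym rot^j∘rot^i) (proj₂ (proj₂ m-rotation))
    (All.applyUpTo⁻ (λ k → rot^ k u) n (Extrema.f[xs]≤f[argmax] {f = reverse} u rotations) (m%n<n (i + j) n))
    where
    rot^j∘rot^i : rot^ j (rot^ i u) ≡ rot^ ((i + j) % n) u
    rot^j∘rot^i = trans (sym (rot^-+ i j u)) (rot^-%-period (rot^-length-period u) (i + j))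

-- Periods and leading zeros

private
  -- findPeriod is private to Defs; unification recovers it once its two arguments are abstracted.
  findPeriodOf : Σ (Word → List ℕ → ℕ → ℕ) λ findPeriod →
    ∀ u → numRotations u ≡ findPeriod u (map suc (upTo (length u))) (length u)
  proj₁ findPeriodOf = _
  proj₂ findPeriodOf u with length u
  ... | n with map suc (upTo n)
  ...   | ds = refl

IsPeriod : Word → ℕ → Set
IsPeriod u d = 0 < d × rot^ d u ≡ u

numRotations-period : ∀ u → 0 < length u → IsPeriod u (numRotations u)
numRotations-period u 0<∣u∣ = subst (IsPeriod u) (sym (proj₂ findPeriodOf u))
  (search (map suc (upTo (length u))) candidates (0<∣u∣ , rot^-length-period u))
  where
  findPeriod = proj₁ findPeriodOf
  candidates : All (λ d → 0 < d × d ≤ length u) (map suc (upTo (length u)))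
  candidates = All.map⁺ (All.applyUpTo⁺₁ (λ j → j) (length u) λ j<n → s≤s z≤n , j<n)
  search : ∀ ds {dflt} → All (λ d → 0 < d × d ≤ length u) ds → IsPeriod u dflt →
           IsPeriod u (findPeriod u ds dflt)
  search []       []                   period = period
  search (d ∷ ds) ((0<d , d≤∣u∣) ∷ cs) period with rotate d u ==ʷ u in found
  ... | true  = 0<d , trans (sym (rotate≡rot^ d u d≤∣u∣)) (==ʷ-sound _ _ (Equivalence.from T-≡ found))
  ... | false = search ds cs period

zeros⊎leading-nonzero : ∀ u → u ≡ replicate (length u) 0 ⊎ ∃₂ λ L τ → ∃ λ w → u ≡ replicate L 0 ++ suc τ ∷ w
zeros⊎leading-nonzero []          = inj₁ refl
zeros⊎leading-nonzero (suc τ ∷ w) = inj₂ (0 , τ , w , refl)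
zeros⊎leading-nonzero (zero ∷ u) with zeros⊎leading-nonzero u
... | inj₁ u≡0ⁿ              = inj₁ (cong (0 ∷_) u≡0ⁿ)
... | inj₂ (L , τ , w , u≡) = inj₂ (suc L , τ , w , cong (0 ∷_) u≡)

leadingZeros-nonzero : ∀ L τ w → leadingZeros (replicate L 0 ++ suc τ ∷ w) ≡ (L , suc τ ∷ w)
leadingZeros-nonzero zero    τ w = refl
leadingZeros-nonzero (suc L) τ w rewrite leadingZeros-nonzero L τ w = refl

leadingZeros-replicate-≥ : ∀ l u → l ≤ proj₁ (leadingZeros (replicate l 0 ++ u))
leadingZeros-replicate-≥ zero    u = z≤n
leadingZeros-replicate-≥ (suc l) u = s≤s (leadingZeros-replicate-≥ l u)

period-exceeds-zeros : ∀ L τ w {d} → IsPeriod (replicate L 0 ++ suc τ ∷ w) d → L < d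
period-exceeds-zeros L τ w {d} (0<d , period) = ≰⇒> d≰L
  where
  d≰L : ¬ d ≤ L
  d≰L d≤L = <-irrefl fewer-zeros (∸-monoʳ-< 0<d d≤L)
    where
    rotated : rot^ d (replicate L 0 ++ suc τ ∷ w) ≡ replicate (L ∸ d) 0 ++ suc τ ∷ w ++ replicate d 0
    rotated = subst (λ m → rot^ d (replicate m 0 ++ suc τ ∷ w) ≡ replicate (L ∸ d) 0 ++ suc τ ∷ w ++ replicate d 0)
                    (m+[n∸m]≡n d≤L)
                    (rot^-replicate-+ d (L ∸ d) 0 (suc τ ∷ w))
    fewer-zeros : L ∸ d ≡ L
    fewer-zeros = begin
      L ∸ d                                                                    ≡⟨ cong proj₁ (leadingZeros-nonzero (L ∸ d) τ _) ⟨
      proj₁ (leadingZeros (replicate (L ∸ d) 0 ++ suc τ ∷ w ++ replicate d 0)) ≡⟨ cong (proj₁ ∘ leadingZeros) (trans (sym rotated) period) ⟩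
      proj₁ (leadingZeros (replicate L 0 ++ suc τ ∷ w))                        ≡⟨ cong proj₁ (leadingZeros-nonzero L τ w) ⟩
      L                                                                        ∎
      where open ≡-Reasoning

rot^-zeros : ∀ L τ w → rot^ L (replicate L 0 ++ suc τ ∷ w) ≡ suc τ ∷ w ++ replicate L 0
rot^-zeros L τ w = rot^-replicate-++ L 0 (suc τ ∷ w)

rot^-past-zeros : ∀ L τ w → rot^ (suc L) (replicate L 0 ++ suc τ ∷ w) ≡ w ++ replicate L 0 ++ [ suc τ ]
rot^-past-zeros L τ w = begin
  rot^ (suc L) K                    ≡⟨ cong (λ m → rot^ m K) (+-comm 1 L) ⟩
  rot^ (L + 1) K                    ≡⟨ rot^-+ L 1 K ⟩
  rot1 (rot^ L K)                   ≡⟨ cong rot1 (rot^-zeros L τ w) ⟩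
  (w ++ replicate L 0) ++ [ suc τ ] ≡⟨ ++-assoc w (replicate L 0) [ suc τ ] ⟩
  w ++ replicate L 0 ++ [ suc τ ]   ∎
  where
  open ≡-Reasoning
  K = replicate L 0 ++ suc τ ∷ w

rot^-decrement-<ᶜ : ∀ i L τ w → rot^ i (τ ∷ w ++ replicate L 0) <ᶜ rot^ (L + i) (replicate L 0 ++ suc τ ∷ w)
rot^-decrement-<ᶜ i L τ w = subst₂ _<ᶜ_ (sym (rot^-moves τ)) (sym rot^-L+i) (<ᶜ-letter xs ys (n<1+n τ))
  where
  moved = rot^-letter i [] (w ++ replicate L 0)
  xs = proj₁ moved
  ys = proj₁ (proj₂ moved)
  rot^-moves = proj₂ (proj₂ moved)
  rot^-L+i : rot^ (L + i) (replicate L 0 ++ suc τ ∷ w) ≡ xs ++ suc τ ∷ ys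
  rot^-L+i = trans (rot^-+ L i _) (trans (cong (rot^ i) (rot^-zeros L τ w)) (rot^-moves (suc τ)))

-- The lists of words and of key-words

All-reverse : ∀ {P : ℕ → Set} {u} → All P u → All P (reverse u)
All-reverse         []        = []
All-reverse {P} {x ∷ u} (px ∷ pu) =
  subst (All P) (sym (unfold-reverse x u)) (All.++⁺ (All-reverse pu) (px ∷ []))

reverse-replicate : ∀ n (x : ℕ) → reverse (replicate n x) ≡ replicate n x
reverse-replicate zero    x = refl
reverse-replicate (suc n) x = begin
  reverse (x ∷ replicate n x)      ≡⟨ unfold-reverse x (replicate n x) ⟩
  reverse (replicate n x) ++ [ x ] ≡⟨ cong (_++ [ x ]) (reverse-replicate n x) ⟩
  replicate n x ++ [ x ]           ≡⟨ replicate-∷ʳ n x ⟩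
  x ∷ replicate n x                ∎
  where open ≡-Reasoning

All-<-suc-sum : ∀ u → All (_< suc (sum u)) u
All-<-suc-sum []      = []
All-<-suc-sum (x ∷ u) =
  s≤s (m≤m+n x (sum u)) ∷ All-map (λ y<s → ≤-trans y<s (s≤s (m≤n+m (sum u) x))) (All-<-suc-sum u)

∈-wordsLex⁻ : ∀ k n {u} → u ∈ wordsLex k n → length u ≡ n × All (_< k) u
∈-wordsLex⁻ k zero    (here refl) = refl , []
∈-wordsLex⁻ k (suc n) u∈          =
  let a , a∈ , u∈block = find (∈-concatMap⁻ (λ a → map (a ∷_) (wordsLex k n)) {xs = upTo k} u∈)
      v , v∈ , u≡a∷v   = ∈-map⁻ (a ∷_) u∈block
      ∣v∣≡n , v<k      = ∈-wordsLex⁻ k n v∈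
  in trans (cong length u≡a∷v) (cong suc ∣v∣≡n) , subst (All (_< k)) (sym u≡a∷v) (∈-upTo⁻ a∈ ∷ v<k)

∈-wordsLex⁺ : ∀ k {u} → All (_< k) u → u ∈ wordsLex k (length u)
∈-wordsLex⁺ k []                  = here refl
∈-wordsLex⁺ k {a ∷ u} (a<k ∷ u<k) =
  ∈-concatMap⁺ (λ a → map (a ∷_) (wordsLex k (length u))) {xs = upTo k}
    (lose (∈-upTo⁺ a<k) (∈-map⁺ (a ∷_) (∈-wordsLex⁺ k u<k)))

wordsLex-sorted : ∀ k n → AllPairs _<ˡ_ (wordsLex k n)
wordsLex-sorted k zero    = [] ∷ []
wordsLex-sorted k (suc n) = AllPairs.concat⁺
  (All.map⁺ (universal (λ a → AllPairs.map⁺ (AP.map (next refl) (wordsLex-sorted k n))) (upTo k)))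
  (AllPairs.map⁺ (AllPairs.applyUpTo⁺₁ (λ a → a) k λ a<b _ →
    All.map⁺ (universal (λ _ → All.map⁺ (universal (λ _ → this a<b) _)) _)))

wordsLex-head : ∀ k n → ∃ λ W → wordsLex (suc k) n ≡ replicate n 0 ∷ W
wordsLex-head k zero    = [] , refl
wordsLex-head k (suc n) with wordsLex-head k n
... | W , eq rewrite eq = _ , refl

isKey? : ∀ u → Dec (isKeyB u ≡ true)
isKey? u = isKeyB u Data.Bool.≟ true

keys-sorted : ∀ n k → AllPairs _<ᶜ_ (keys n k)
keys-sorted n k = AllPairs.filter⁺ isKey? (AllPairs.map⁺ (AP.map reversed (wordsLex-sorted k n)))
  where
  reversed : ∀ {u v} → u <ˡ v → reverse (reverse u) <ˡ reverse (reverse v)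
  reversed {u} {v} = subst₂ _<ˡ_ (sym (reverse-involutive u)) (sym (reverse-involutive v))

∈-keys⁻ : ∀ n k {u} → u ∈ keys n k → length u ≡ n × All (_< k) u × T (isKeyB u)
∈-keys⁻ n k u∈ =
  let u∈colex , key = ∈-filter⁻ isKey? {xs = wordsColex k n} u∈
      v , v∈ , u≡rv = ∈-map⁻ reverse u∈colex
      ∣v∣≡n , v<k   = ∈-wordsLex⁻ k n v∈
  in trans (cong length u≡rv) (trans (length-reverse v) ∣v∣≡n) ,
     subst (All (_< k)) (sym u≡rv) (All-reverse v<k) ,
     Equivalence.from T-≡ key

∈-keys⁺ : ∀ k {u} → All (_< k) u → T (isKeyB u) → u ∈ keys (length u) k
∈-keys⁺ k {u} u<k key =
  ∈-filter⁺ isKey? (subst (_∈ wordsColex k (length u)) (reverse-involutive u) reverse∈) (Equivalence.to T-≡ key)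
  where
  reverse∈ : reverse (reverse u) ∈ wordsColex k (length u)
  reverse∈ = ∈-map⁺ reverse (subst (λ m → reverse u ∈ wordsLex k m) (length-reverse u)
               (∈-wordsLex⁺ k (All-reverse u<k)))

keys-head : ∀ n k → ∃ λ rest → keys n (suc k) ≡ replicate n 0 ∷ rest
keys-head n k with wordsLex-head k n
... | W , eq rewrite eq | reverse-replicate n 0 =
  _ , filter-accept isKey? (Equivalence.to T-≡ (IsMaxRotation⇒isKeyB _ λ i → ≤ᶜ-reflexive (rot^-replicate i n 0)))

AllPairs-smaller⇒∈-prefix :
  ∀ {A : Set} {_≺_ : A → A → Set} → (∀ {x} → ¬ x ≺ x) → (∀ {x y z} → x ≺ y → y ≺ z → x ≺ z) →
  ∀ xs {y ys x} → AllPairs _≺_ (xs ++ y ∷ ys) → x ∈ xs ++ y ∷ ys → x ≺ y → x ∈ xs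
AllPairs-smaller⇒∈-prefix irrefl trans []       (y≺ys ∷ _) (here refl)  x≺y = ⊥-elim (irrefl x≺y)
AllPairs-smaller⇒∈-prefix irrefl trans []       (y≺ys ∷ _) (there x∈ys) x≺y =
  ⊥-elim (irrefl (trans x≺y (lookup y≺ys x∈ys)))
AllPairs-smaller⇒∈-prefix irrefl trans (_ ∷ xs) _          (here refl)  _   = here refl
AllPairs-smaller⇒∈-prefix irrefl trans (_ ∷ xs) (_ ∷ sorted) (there x∈) x≺y =
  there (AllPairs-smaller⇒∈-prefix irrefl trans xs sorted x∈ x≺y)

-- Insertion and cycles

⊆-insertAfter : ∀ t s D → D ⊆ insertAfter t s D
⊆-insertAfter t s []      = []
⊆-insertAfter t s (x ∷ D) with x ==ʷ t
... | true  = refl ∷ Sublist.++⁺ˡ s ⊆-refl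
... | false = refl ∷ ⊆-insertAfter t s D

insertAfter-⊇ : ∀ t s D → t ∈ D → s ⊆ insertAfter t s D
insertAfter-⊇ t s (x ∷ D) t∈ with x ==ʷ t in x==t
... | true = x ∷ʳ Sublist.++⁺ʳ D ⊆-refl
insertAfter-⊇ t s (x ∷ D) (here refl) | false = ⊥-elim (subst T x==t (==ʷ-refl x))
insertAfter-⊇ t s (x ∷ D) (there t∈)  | false = x ∷ʳ insertAfter-⊇ t s D t∈

⊆-step : ∀ D K → D ⊆ step D K
⊆-step D K with leadingZeros K
... | l , suc σ ∷ w = ⊆-insertAfter _ _ D
... | l , zero ∷ w  = ⊆-refl
... | l , []        = ⊆-refl

⊆-foldl-step : ∀ D Ks → D ⊆ foldl step D Ks
⊆-foldl-step D []       = ⊆-refl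
⊆-foldl-step D (K ∷ Ks) = ⊆-trans (⊆-step D K) (⊆-foldl-step (step D K) Ks)

step-nonzero : ∀ D L τ w → let K = replicate L 0 ++ suc τ ∷ w in
  step D K ≡ insertAfter (τ ∷ w ++ replicate L 0) (iterRot (numRotations K) (rot^ (suc L) K)) D
step-nonzero D L τ w rewrite leadingZeros-nonzero L τ w | rot^-past-zeros L τ w = refl

⊆⇒AppearsBefore : ∀ {L u v} → u ∷ v ∷ [] ⊆ L → AppearsBefore L u v
⊆⇒AppearsBefore (x ∷ʳ uv⊆L) =
  let xs , ys , zs , L≡ = ⊆⇒AppearsBefore uv⊆L in x ∷ xs , ys , zs , cong (x ∷_) L≡
⊆⇒AppearsBefore (refl ∷ v⊆L) =
  let ys , zs , L≡ = ∈-∃++ (to∈ v⊆L) in [] , ys , zs , cong (_ ∷_) L≡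

∈-iterRot : ∀ {i d} s → i < d → rot^ i s ∈ iterRot d s
∈-iterRot {zero}  {suc d} s _         = here refl
∈-iterRot {suc i} {suc d} s (s≤s i<d) = there (∈-iterRot (rot1 s) i<d)

iterRot-⊇ : ∀ {i j d} s → i < j → j < d → rot^ i s ∷ rot^ j s ∷ [] ⊆ iterRot d s
iterRot-⊇ {zero}  {suc j} {suc d} s _         (s≤s j<d) = refl ∷ from∈ (∈-iterRot (rot1 s) j<d)
iterRot-⊇ {suc i} {suc j} {suc d} s (s≤s i<j) (s≤s j<d) = s ∷ʳ iterRot-⊇ (rot1 s) i<j j<d

module _ {K d} (period : rot^ d K ≡ K) where

  rot^-shift : ∀ {m} i → m ≤ d → rot^ i K ≡ rot^ (d ∸ m + i) (rot^ m K)
  rot^-shift {m} i m≤d = begin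
    rot^ i K                    ≡⟨ cong (rot^ i) period ⟨
    rot^ i (rot^ d K)           ≡⟨ rot^-+ d i K ⟨
    rot^ (d + i) K              ≡⟨ cong (λ k → rot^ (k + i) K) (m+[n∸m]≡n m≤d) ⟨
    rot^ (m + (d ∸ m) + i) K    ≡⟨ cong (λ k → rot^ k K) (+-assoc m (d ∸ m) i) ⟩
    rot^ (m + (d ∸ m + i)) K    ≡⟨ rot^-+ m (d ∸ m + i) K ⟩
    rot^ (d ∸ m + i) (rot^ m K) ∎
    where open ≡-Reasoning

  ∈-iterRot-rot^ : ∀ {m} i → 0 < d → m ≤ d → rot^ i K ∈ iterRot d (rot^ m K)
  ∈-iterRot-rot^ {m} i 0<d m≤d =
    subst (_∈ iterRot d (rot^ m K)) (sym rot^i≡) (∈-iterRot (rot^ m K) (m%n<n j d))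
    where
    instance
      d≢0 : NonZero d
      d≢0 = >-nonZero 0<d
    j = d ∸ m + i
    rot^i≡ : rot^ i K ≡ rot^ (j % d) (rot^ m K)
    rot^i≡ = trans (rot^-shift i m≤d) (rot^-%-period (trans (rot^-comm d m K) (cong (rot^ m) period)) j)

  iterRot-rot^-⊇ : ∀ {m a b} → m ≤ d → a < b → b < m → rot^ a K ∷ rot^ b K ∷ [] ⊆ iterRot d (rot^ m K)
  iterRot-rot^-⊇ {m} {a} {b} m≤d a<b b<m =
    subst₂ (λ u v → u ∷ v ∷ [] ⊆ iterRot d (rot^ m K)) (sym (rot^-shift a m≤d)) (sym (rot^-shift b m≤d))
      (iterRot-⊇ (rot^ m K) (+-monoʳ-< (d ∸ m) a<b) within)
    where
    within : d ∸ m + b < d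
    within = subst (d ∸ m + b <_) (m∸n+n≡m m≤d) (+-monoʳ-< (d ∸ m) b<m)

-- The construction of D(n,k)

module Construction (n k : ℕ) (0<n : 0 < n) {rest : List Word}
                    (keys≡ : keys n (suc k) ≡ replicate n 0 ∷ rest) where

  Z : Word
  Z = replicate n 0

  sorted : AllPairs _<ᶜ_ (Z ∷ rest)
  sorted = subst (AllPairs _<ᶜ_) keys≡ (keys-sorted n (suc k))

  D : List Word → List Word
  D = foldl step (Z ∷ [])

  Saturated : List Word → Set
  Saturated xs = ∀ {K} → K ∈ Z ∷ xs → ∀ i → rot^ i K ∈ D xs

  key∈ : ∀ xs {K ys} → rest ≡ xs ++ K ∷ ys → K ∈ keys n (suc k)
  key∈ xs rest≡ = subst (_ ∈_) (sym keys≡) (there (subst (_ ∈_) (sym rest≡) (∈-++⁺ʳ xs (here refl))))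

  nonzero-key-shape : ∀ {K} → K ∈ rest → ∃₂ λ L τ → ∃ λ w → K ≡ replicate L 0 ++ suc τ ∷ w
  nonzero-key-shape {K} K∈ with zeros⊎leading-nonzero K
  ... | inj₂ shape = shape
  ... | inj₁ K≡0ⁿ  = ⊥-elim (<ˡ-irrefl (subst (Z <ᶜ_) K≡Z Z<K))
    where
    K≡Z : K ≡ Z
    K≡Z = trans K≡0ⁿ (cong (λ m → replicate m 0) (proj₁ (∈-keys⁻ n (suc k) (subst (K ∈_) (sym keys≡) (there K∈)))))
    Z<K : Z <ᶜ K
    Z<K with sorted
    ... | Z<rest ∷ _ = lookup Z<rest K∈

  key-period : ∀ xs {ys} L τ w → let K = replicate L 0 ++ suc τ ∷ w in
               rest ≡ xs ++ K ∷ ys → IsPeriod K (numRotations K) × L < numRotations K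
  key-period xs L τ w rest≡ = period , period-exceeds-zeros L τ w period
    where
    period = numRotations-period _ (subst (0 <_) (sym (proj₁ (∈-keys⁻ n (suc k) (key∈ xs rest≡)))) 0<n)

  -- t is a rotation of its maximal rotation K′, a key-word colex-below K and hence already in Z ∷ xs.
  insertion-point : ∀ xs {ys} L τ w → rest ≡ xs ++ (replicate L 0 ++ suc τ ∷ w) ∷ ys → Saturated xs →
                    τ ∷ w ++ replicate L 0 ∈ D xs
  insertion-point xs L τ w rest≡ saturated =
    subst (_∈ D xs) (rot^-inverse i t (<⇒≤ i<∣t∣)) (saturated K′∈ (length t ∸ i))
    where
    K = replicate L 0 ++ suc τ ∷ w
    t = τ ∷ w ++ replicate L 0
    K-key = ∈-keys⁻ n (suc k) (key∈ xs rest≡)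
    ∣K∣≡n = proj₁ K-key
    max-rotation = maxRotation t (s≤s z≤n)
    i = proj₁ max-rotation
    i<∣t∣ = proj₁ (proj₂ max-rotation)
    K′ = rot^ i t
    K′<K : K′ <ᶜ K
    K′<K = <ˡ-≤ˡ-trans (rot^-decrement-<ᶜ i L τ w)
             (isKeyB⇒IsMaxRotation K (subst (0 <_) (sym ∣K∣≡n) 0<n) (proj₂ (proj₂ K-key)) (L + i))
    ∣t∣≡n : length t ≡ n
    ∣t∣≡n = trans (cong length (sym (rot^-zeros L τ w))) (trans (length-rot^ L K) ∣K∣≡n)
    t<suc-k : All (_< suc k) t
    t<suc-k with subst (All (_< suc k)) (rot^-zeros L τ w) (All-rot^ L (proj₁ (proj₂ K-key)))
    ... | suc-τ<suc-k ∷ rest<suc-k = <⇒≤ suc-τ<suc-k ∷ rest<suc-k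
    K′-key : K′ ∈ keys n (suc k)
    K′-key = subst (λ m → K′ ∈ keys m (suc k)) (trans (length-rot^ i t) ∣t∣≡n)
      (∈-keys⁺ (suc k) (All-rot^ i t<suc-k) (IsMaxRotation⇒isKeyB K′ (proj₂ (proj₂ max-rotation))))
    K′∈ : K′ ∈ Z ∷ xs
    K′∈ = AllPairs-smaller⇒∈-prefix <ˡ-irrefl <ˡ-trans (Z ∷ xs)
            (subst (λ r → AllPairs _<ᶜ_ (Z ∷ r)) rest≡ sorted)
            (subst (K′ ∈_) (trans keys≡ (cong (Z ∷_) rest≡)) K′-key) K′<K

  cycle-inserted : ∀ xs {ys} L τ w → let K = replicate L 0 ++ suc τ ∷ w in
                   rest ≡ xs ++ K ∷ ys → Saturated xs →
                   iterRot (numRotations K) (rot^ (suc L) K) ⊆ D (xs ++ [ K ])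
  cycle-inserted xs L τ w rest≡ saturated =
    subst (_ ⊆_) (sym (trans (foldl-++ step (Z ∷ []) xs [ _ ]) (step-nonzero (D xs) L τ w)))
      (insertAfter-⊇ _ _ (D xs) (insertion-point xs L τ w rest≡ saturated))

  saturated-[] : Saturated []
  saturated-[] (here refl) i = subst (_∈ Z ∷ []) (sym (rot^-replicate i n 0)) (here refl)

  saturated-∷ʳ : ∀ xs {K ys} → rest ≡ xs ++ K ∷ ys → Saturated xs → Saturated (xs ++ [ K ])
  saturated-∷ʳ xs {K} rest≡ saturated K′∈ i with ∈-++⁻ (Z ∷ xs) K′∈
  ... | inj₁ K′∈Z∷xs =
        subst (_ ∈_) (sym (foldl-++ step (Z ∷ []) xs [ K ])) (lookup-⊆ (⊆-step (D xs) K) (saturated K′∈Z∷xs i))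
  ... | inj₂ (here refl) with nonzero-key-shape (subst (K ∈_) (sym rest≡) (∈-++⁺ʳ xs (here refl)))
  ...   | L , τ , w , refl =
          let (0<d , period) , L<d = key-period xs L τ w rest≡ in
          lookup-⊆ (cycle-inserted xs L τ w rest≡ saturated) (∈-iterRot-rot^ period i 0<d L<d)

  saturated-++ : ∀ xs ys {zs} → rest ≡ xs ++ ys ++ zs → Saturated xs → Saturated (xs ++ ys)
  saturated-++ xs []       _     saturated = subst Saturated (sym (++-identityʳ xs)) saturated
  saturated-++ xs (K ∷ ys) {zs} rest≡ saturated = subst Saturated (++-assoc xs [ K ] ys)
    (saturated-++ (xs ++ [ K ]) ys (trans rest≡ (sym (++-assoc xs [ K ] (ys ++ zs))))
      (saturated-∷ʳ xs rest≡ saturated))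

  rotations-ordered : ∀ L τ w → let K = replicate L 0 ++ suc τ ∷ w in
                      K ∈ rest → ∀ {a b} → a < b → b ≤ L → rot^ a K ∷ rot^ b K ∷ [] ⊆ Dseq n (suc k)
  rotations-ordered L τ w K∈ a<b b≤L with ∈-∃++ K∈
  ... | xs , ys , rest≡ =
    let (_ , period) , L<d = key-period xs L τ w rest≡ in
    ⊆-trans (iterRot-rot^-⊇ period L<d a<b (s≤s b≤L))
   (⊆-trans (cycle-inserted xs L τ w rest≡ (saturated-++ [] xs rest≡ saturated-[]))
            (subst (D (xs ++ [ K ]) ⊆_) Dseq≡ (⊆-foldl-step (D (xs ++ [ K ])) ys)))
    where
    K = replicate L 0 ++ suc τ ∷ w
    Dseq≡ : foldl step (D (xs ++ [ K ])) ys ≡ Dseq n (suc k)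
    Dseq≡ = sym (begin
      Dseq n (suc k)                  ≡⟨ cong (λ ks → foldl step (Z ∷ []) (drop 1 ks)) keys≡ ⟩
      D rest                          ≡⟨ cong D (trans rest≡ (sym (++-assoc xs [ K ] ys))) ⟩
      D ((xs ++ [ K ]) ++ ys)         ≡⟨ foldl-++ step (Z ∷ []) (xs ++ [ K ]) ys ⟩
      foldl step (D (xs ++ [ K ])) ys ∎)
      where open ≡-Reasoning

rotations-before : ∀ n {K} → 0 < n → IsKeyWord n K → K ≢ replicate n 0 →
                   ∀ {a b} → a < b → b ≤ proj₁ (leadingZeros K) → Before n (rot^ a K) (rot^ b K)
rotations-before n {K} 0<n key K≢0ⁿ {a} {b} a<b b≤L with keys-head n (sum K)
... | rest , keys≡ = suc (sum K) , All-rot^ a K<k , All-rot^ b K<k , ⊆⇒AppearsBefore ordered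
  where
  open Construction n (sum K) 0<n keys≡
  K<k = All-<-suc-sum K
  K∈rest : K ∈ rest
  K∈rest with subst (K ∈_) keys≡ (subst (λ m → K ∈ keys m (suc (sum K))) (proj₁ key)
                                  (∈-keys⁺ _ K<k (IsKeyWord⇒isKeyB n K key)))
  ... | here K≡0ⁿ = ⊥-elim (K≢0ⁿ K≡0ⁿ)
  ... | there K∈  = K∈
  ordered : rot^ a K ∷ rot^ b K ∷ [] ⊆ Dseq n (suc (sum K))
  ordered with nonzero-key-shape K∈rest
  ... | L , τ , w , K≡ =
    subst (λ K′ → rot^ a K′ ∷ rot^ b K′ ∷ [] ⊆ Dseq n (suc (sum K))) (sym K≡)
      (rotations-ordered L τ w (subst (_∈ rest) K≡ K∈rest) a<b
        (subst (b ≤_) (trans (cong (proj₁ ∘ leadingZeros) K≡) (cong proj₁ (leadingZeros-nonzero L τ w))) b≤L))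

lemma2 : (n : ℕ) → 1 ≤ n → (l σ : ℕ) → (w : List ℕ) → (p : ℕ) →
    IsKeyWord n (replicate l 0 ++ σ ∷ w) →
    replicate l 0 ++ σ ∷ w ≢ replicate n 0 →
    0 < p → p ≤ l →
    Before n (replicate p 0 ++ σ ∷ w ++ replicate (l ∸ p) 0) (σ ∷ w ++ replicate l 0)
lemma2 n 0<n l σ w p key K≢0ⁿ 0<p p≤l =
  subst₂ (Before n) rot^-l∸p (rot^-replicate-++ l 0 (σ ∷ w))
    (rotations-before n 0<n key K≢0ⁿ (∸-monoʳ-< 0<p p≤l) (leadingZeros-replicate-≥ l (σ ∷ w)))
  where
  rot^-l∸p : rot^ (l ∸ p) (replicate l 0 ++ σ ∷ w) ≡ replicate p 0 ++ σ ∷ w ++ replicate (l ∸ p) 0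
  rot^-l∸p = subst (λ m → rot^ (l ∸ p) (replicate m 0 ++ σ ∷ w) ≡ replicate p 0 ++ σ ∷ w ++ replicate (l ∸ p) 0)
               (m∸n+n≡m p≤l)
               (rot^-replicate-+ (l ∸ p) p 0 (σ ∷ w))
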